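{- Let $L$ be the graph with vertex set $\{x_i, y_i : i \in \mathbb{Z}\}$ and edges $\{x_i,y_i\}$, $\{x_i,y_{i+1}\}$, $\{x_{i+1},y_i\}$ for all $i\in\mathbb{Z}$ (the twisted square ladder, infinite in both directions). Fix the configuration $T=\{y_i:i\in\mathbb{Z}\}$ (the tail type). Let $\mathcal{C}$ be the set of configurations $\chi$ of $L$ such that the set of occupied columns $\Omega(\chi)$ is a Dirac set and $\chi$ agrees with $T$ on all sufficiently negative columns. Then $$F(t,q):=\sum_{\chi\in\mathcal{C}} t^{C(\Omega(\chi))}q^{U(\Omega(\chi))}=\prod_{m=1}^{\infty}\frac{1+q^m}{1-q^m}\sum_{n=-\infty}^{\infty}q^{n(n-1)/2}t^n .$$
   Context: A configuration of a graph is a set of vertices (positions of particles, at most one per vertex) containing no two vertices joined by an edge. Column $i$ consists of $x_i,y_i$; each column holds at most one particle, and $\Omega(\chi)\subset\mathbb{Z}$ is the set of indices of occupied columns. A set $\Omega\subset\mathbb{Z}$ is a Dirac set if $\Omega_e=\Omega\cap\mathbb{Z}_{\ge0}$ and $\Omega_p=\mathbb{Z}_{<0}\setminus\Omega$ are finite; its charge is $C(\Omega)=|\Omega_e|-|\Omega_p|$ and its energy is $U(\Omega)=\sum_{\alpha\in\Omega_e\cup\Omega_p}|\alpha|$. -}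

module Defs where

open import Data.Bool using (Bool; true; false; if_then_else_; not; _∨_)
open import Data.Nat as ℕ using (ℕ; zero; suc; _≡ᵇ_; _%_)
open import Data.Nat.Properties using (_≤?_)
open import Data.Integer as ℤ using (ℤ; +_; -[1+_])
open import Data.List using (List; []; _∷_; map; upTo)
open import Data.Nat.ListAction using (sum)
open import Data.Product using (_×_; ∃; ∃-syntax)
open import Relation.Nullary using (¬_; yes; no)
open import Relation.Binary.PropositionalEquality using (_≡_)

data Vertex : Set where
  x : ℤ → Vertex
  y : ℤ → Vertex

data Edge : Vertex → Vertex → Set where
  rung   : ∀ i → Edge (x i) (y i)
  diag₁  : ∀ i → Edge (x i) (y (i ℤ.+ ℤ.1ℤ))
  diag₂  : ∀ i → Edge (x (i ℤ.+ ℤ.1ℤ)) (y i)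
  sym-e  : ∀ {v w} → Edge v w → Edge w v

VSet : Set
VSet = Vertex → Bool

IsConfiguration : VSet → Set
IsConfiguration χ = ∀ {v w} → Edge v w → ¬ (χ v ≡ true × χ w ≡ true)

_≈_ : VSet → VSet → Set
χ ≈ ψ = ∀ v → χ v ≡ ψ v

T : VSet
T (x _) = false
T (y _) = true

AgreesWithTailEventually : VSet → Set
AgreesWithTailEventually χ =
  ∃[ N ] (∀ i → i ℤ.< N → (χ (x i) ≡ T (x i)) × (χ (y i) ≡ T (y i)))

Ω : VSet → (ℤ → Bool)
Ω χ i = χ (x i) ∨ χ (y i)

-- M bounds Ω_e = Ω ∩ ℤ≥0 ⊆ [0,M) and Ω_p = ℤ<0 \ Ω ⊆ [-M,-1]
DiracBound : (ℤ → Bool) → ℕ → Set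
DiracBound S M =
  (∀ k → M ℕ.≤ k → S (+ k) ≡ false) × (∀ k → M ℕ.≤ k → S (-[1+ k ]) ≡ true)

IsDirac : (ℤ → Bool) → Set
IsDirac S = ∃[ M ] DiracBound S M

ind : Bool → ℕ
ind true  = 1
ind false = 0

below : ℕ → List ℕ
below M = upTo M

card-e : (ℤ → Bool) → ℕ → ℕ
card-e S M = sum (map (λ k → ind (S (+ k))) (below M))

card-p : (ℤ → Bool) → ℕ → ℕ
card-p S M = sum (map (λ k → ind (not (S (-[1+ k ])))) (below M))

chargeWithin : (ℤ → Bool) → ℕ → ℤ
chargeWithin S M = + card-e S M ℤ.- + card-p S M

energyWithin : (ℤ → Bool) → ℕ → ℕ
energyWithin S M =
  sum (map (λ k → ind (S (+ k)) ℕ.* k) (below M))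
  ℕ.+ sum (map (λ k → ind (not (S (-[1+ k ]))) ℕ.* suc k) (below M))

-- S is a Dirac set with C(S) = n and U(S) = u
-- (the values do not depend on the choice of valid bound M)
HasChargeEnergy : (ℤ → Bool) → ℤ → ℕ → Set
HasChargeEnergy S n u =
  ∃[ M ] (DiracBound S M × chargeWithin S M ≡ n × energyWithin S M ≡ u)

Inℂ : VSet → Set
Inℂ χ = IsConfiguration χ × IsDirac (Ω χ) × AgreesWithTailEventually χ

Series : Set
Series = ℕ → ℕ

_⊛_ : Series → Series → Series
(f ⊛ g) k = sum (map (λ i → f i ℕ.* g (k ℕ.∸ i)) (upTo (suc k)))

one : Series
one k = if k ≡ᵇ 0 then 1 else 0

onePlus : ℕ → Series
onePlus m k = (if k ≡ᵇ 0 then 1 else 0) ℕ.+ (if k ≡ᵇ m then 1 else 0)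

-- 1/(1 - q^(suc j)) = Σ_r q^(r·(suc j))
geom : ℕ → Series
geom j k = if (k % suc j) ≡ᵇ 0 then 1 else 0

-- (1+q^m)/(1-q^m) with m = suc j
factor : ℕ → Series
factor j = onePlus (suc j) ⊛ geom j

partialProd : ℕ → Series
partialProd zero    = one
partialProd (suc K) = partialProd K ⊛ factor K

-- ∏_{m=1}^{∞} (1+q^m)/(1-q^m): the coefficient of q^k only involves m ≤ k
infProd : Series
infProd k = partialProd k k

-- n(n-1)/2 (a natural number for every integer n)
tri : ℤ → ℕ
tri n = ℤ.∣ n ℤ.* (n ℤ.- ℤ.1ℤ) ∣ ℕ./ 2

rhsCoeff : ℤ → ℕ → ℕ
rhsCoeff n u with tri n ≤? u
... | yes _ = infProd (u ℕ.∸ tri n)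
... | no  _ = 0

module Submission where

-- Record a configuration column by column: a column is empty (E) or carries its particle on x (X)
-- or on y (Y), and the diagonal edges forbid an X next to a Y. A configuration in 𝒞 is all Y far to
-- the left and empty far to the right, so from its first empty column p on it is a sequence of
-- segments, each an empty column followed by a run of X's or of Y's: a code (h₁, …, h_K) whose parts
-- have sizes s_i. Building the configuration from a filled Dirac sea, every particle added at column c
-- raises the charge by 1 and the energy by c, so the charge is n = p + Σ s_i and the energy is
-- n(n-1)/2 + Σ i s_i. The configurations of charge n and energy u thus correspond to the codes with
-- Σ i s_i = k := u - n(n-1)/2 up to trailing empty segments, hence bijectively to such codes of length
-- exactly k. Segment i contributes q^(i(r+1)) as an X-run of length r + 1 and q^(ir) as a Y-run of
-- length r, a factor (1 + q^i)/(1 - q^i); only segments i ≤ k can be nonempty, which is the truncation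
-- used by infProd.

open import Defs
open import Data.Bool using (Bool; true; false; if_then_else_; not; _∨_) renaming (T to True)
open import Data.Empty using (⊥-elim)
open import Data.Integer as ℤ using (ℤ; +_; -[1+_]; 0ℤ; 1ℤ)
import Data.Integer.Properties as ℤ
open import Data.Integer.Tactic.RingSolver using (solve-∀)
open import Data.List
  using (List; []; _∷_; [_]; _++_; _∷ʳ_; map; upTo; drop; length; replicate; concat; cartesianProductWith)
open import Data.List.Membership.Propositional using (_∈_)
open import Data.List.Membership.Propositional.Properties
  using ( ∈-concat⁺′; ∈-concat⁻′; ∈-map⁺; ∈-map⁻; ∈-upTo⁺; ∈-upTo⁻; ∈-++⁻; ∈-++⁺ʳ
        ; ∈-cartesianProductWith⁺; ∈-cartesianProductWith⁻)
open import Data.List.Properties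
  using ( map-++; map-cong; map-∘; upTo-∷ʳ; ++-assoc; ++-identityʳ; ∷ʳ-injective
        ; length-++; length-map; length-replicate)
open import Data.List.Relation.Binary.Disjoint.Propositional using (Disjoint)
open import Data.List.Relation.Unary.All using (All; []; _∷_)
import Data.List.Relation.Unary.All as All
import Data.List.Relation.Unary.All.Properties as All
open import Data.List.Relation.Unary.AllPairs using (AllPairs; []; _∷_)
import Data.List.Relation.Unary.AllPairs as AllPairs
import Data.List.Relation.Unary.AllPairs.Properties as AllPairs
open import Data.List.Relation.Unary.Any using (Any; here)
import Data.List.Relation.Unary.Any as Any
import Data.List.Relation.Unary.Any.Properties as Any
open import Data.List.Relation.Unary.Linked as Linked using (Linked; []; [-]; _∷_)
open import Data.List.Relation.Unary.Unique.Propositional using (Unique)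
import Data.List.Relation.Unary.Unique.Propositional.Properties as Unique
open import Data.List.Reverse using (Reverse; []; _∶_∶ʳ_; reverseView)
open import Data.Nat using (ℕ; zero; suc; _+_; _*_; _∸_; _≤_; _<_; _≤?_; z≤n; s≤s; _≡ᵇ_; _%_)
open import Data.Nat.DivMod using (_/_; m*n/n≡m; m*n%n≡0; m≡m%n+[m/n]*n)
open import Data.Nat.ListAction using (sum)
open import Data.Nat.ListAction.Properties using (sum-++)
open import Data.Nat.Properties
  using ( +-identityʳ; +-comm; +-assoc; ≤-refl; ≤-trans; <-≤-trans; ≤-pred; m≤m+n; m≤n+m
        ; m≤n⇒m≤1+n; <⇒≢; ≤∧≢⇒<; <-irrefl; _≟_)
import Data.Nat.Properties as ℕ
import Data.Nat.Tactic.RingSolver as ℕ-Solver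
open import Data.Product using (_×_; _,_; proj₁; proj₂; ∃-syntax; map₁)
open import Data.Sum using (inj₁; inj₂)
open import Data.Unit using (tt)
open import Function using (_∘_)
open import Relation.Binary.Definitions using (tri<; tri≈; tri>)
open import Relation.Binary.PropositionalEquality hiding ([_])
open import Relation.Nullary using (¬_; yes; no)

∑< : ℕ → (ℕ → ℕ) → ℕ
∑< M f = sum (map f (upTo M))

∑<-suc : ∀ M f → ∑< (suc M) f ≡ ∑< M f + f M
∑<-suc M f = begin
  sum (map f (upTo (suc M)))       ≡⟨ cong (sum ∘ map f) (upTo-∷ʳ M) ⟨
  sum (map f (upTo M ∷ʳ M))        ≡⟨ cong sum (map-++ f (upTo M) [ M ]) ⟩
  sum (map f (upTo M) ++ [ f M ])  ≡⟨ sum-++ (map f (upTo M)) [ f M ] ⟩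
  ∑< M f + (f M + 0)               ≡⟨ cong (_+_ (∑< M f)) (+-identityʳ (f M)) ⟩
  ∑< M f + f M                     ∎
  where open ≡-Reasoning

∑<-cong : ∀ {f g} M → (∀ k → k < M → f k ≡ g k) → ∑< M f ≡ ∑< M g
∑<-cong zero    eq = refl
∑<-cong {f} {g} (suc M) eq rewrite ∑<-suc M f | ∑<-suc M g =
  cong₂ _+_ (∑<-cong M (λ k k<M → eq k (m≤n⇒m≤1+n k<M))) (eq M ≤-refl)

∑<-extend : ∀ f M d → (∀ k → M ≤ k → f k ≡ 0) → ∑< (d + M) f ≡ ∑< M f
∑<-extend f M zero    vanish = refl
∑<-extend f M (suc d) vanish rewrite ∑<-suc (d + M) f | vanish (d + M) (m≤n+m M d) =
  trans (+-identityʳ _) (∑<-extend f M d vanish)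

∑<-zero : ∀ M → ∑< M (λ _ → 0) ≡ 0
∑<-zero zero    = refl
∑<-zero (suc M) = trans (∑<-suc M (λ _ → 0)) (trans (+-identityʳ _) (∑<-zero M))

∑<-bump : ∀ {f g k δ} M → k < M → (∀ i → i ≢ k → f i ≡ g i) → f k ≡ g k + δ →
          ∑< M f ≡ ∑< M g + δ
∑<-bump {f} {g} {k} {δ} (suc M) k<1+M agree at-k
  rewrite ∑<-suc M f | ∑<-suc M g with k ≟ M
... | yes refl = begin
  ∑< M f + f M        ≡⟨ cong₂ _+_ (∑<-cong M (λ i i<M → agree i (<⇒≢ i<M))) at-k ⟩
  ∑< M g + (g M + δ)  ≡⟨ +-assoc (∑< M g) (g M) δ ⟨
  ∑< M g + g M + δ    ∎
  where open ≡-Reasoning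
... | no k≢M = begin
  ∑< M f + f M        ≡⟨ cong₂ _+_ (∑<-bump M k<M agree at-k) (agree M (k≢M ∘ sym)) ⟩
  ∑< M g + δ + g M    ≡⟨ swap (∑< M g) δ (g M) ⟩
  ∑< M g + g M + δ    ∎
  where
  open ≡-Reasoning
  k<M = ≤∧≢⇒< (≤-pred k<1+M) k≢M
  swap : ∀ a b c → a + b + c ≡ a + c + b
  swap = ℕ-Solver.solve-∀

-- Charge and energy computed inside a window

particleAt holeAt : (ℤ → Bool) → ℕ → ℕ
particleAt S k = ind (S (+ k))
holeAt     S k = ind (not (S -[1+ k ]))

-- The energy lives in ℤ so that a particle put into column p shifts it by p whatever the sign of p.
ChargeEnergy : (ℤ → Bool) → ℕ → ℤ → ℤ → Set
ChargeEnergy S M c e = DiracBound S M × chargeWithin S M ≡ c × + energyWithin S M ≡ e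

module _ {S S' : ℤ → Bool} (S≗S' : ∀ z → S z ≡ S' z) where

  DiracBound-cong : ∀ {M} → DiracBound S M → DiracBound S' M
  DiracBound-cong (above , below) =
    (λ k M≤k → trans (sym (S≗S' _)) (above k M≤k)) , (λ k M≤k → trans (sym (S≗S' _)) (below k M≤k))

  chargeWithin-cong : ∀ M → chargeWithin S M ≡ chargeWithin S' M
  chargeWithin-cong M = cong₂ (λ a b → + a ℤ.- + b)
    (∑<-cong M (λ k _ → cong ind (S≗S' (+ k))))
    (∑<-cong M (λ k _ → cong (ind ∘ not) (S≗S' -[1+ k ])))

  energyWithin-cong : ∀ M → energyWithin S M ≡ energyWithin S' M
  energyWithin-cong M = cong₂ _+_
    (∑<-cong M (λ k _ → cong (λ b → ind b * k) (S≗S' (+ k))))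
    (∑<-cong M (λ k _ → cong (λ b → ind (not b) * suc k) (S≗S' -[1+ k ])))

  chargeEnergy-cong : ∀ {M c e} → ChargeEnergy S M c e → ChargeEnergy S' M c e
  chargeEnergy-cong {M} (bound , charge , energy) =
    DiracBound-cong bound ,
    trans (sym (chargeWithin-cong M)) charge ,
    trans (cong +_ (sym (energyWithin-cong M))) energy

module _ {S : ℤ → Bool} {M : ℕ} (bound : DiracBound S M) (d : ℕ) where

  private
    widened : ∀ {k} → d + M ≤ k → M ≤ k
    widened = ≤-trans (m≤n+m M d)

    particle-vanish : ∀ k → M ≤ k → particleAt S k ≡ 0
    particle-vanish k M≤k = cong ind (proj₁ bound k M≤k)

    hole-vanish : ∀ k → M ≤ k → holeAt S k ≡ 0
    hole-vanish k M≤k = cong (ind ∘ not) (proj₂ bound k M≤k)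

  DiracBound-widen : DiracBound S (d + M)
  DiracBound-widen = (λ k le → proj₁ bound k (widened le)) , (λ k le → proj₂ bound k (widened le))

  chargeWithin-widen : chargeWithin S (d + M) ≡ chargeWithin S M
  chargeWithin-widen = cong₂ (λ a b → + a ℤ.- + b)
    (∑<-extend (particleAt S) M d particle-vanish)
    (∑<-extend (holeAt S) M d hole-vanish)

  energyWithin-widen : energyWithin S (d + M) ≡ energyWithin S M
  energyWithin-widen = cong₂ _+_
    (∑<-extend (λ k → particleAt S k * k) M d (λ k le → cong (_* k) (particle-vanish k le)))
    (∑<-extend (λ k → holeAt S k * suc k) M d (λ k le → cong (_* suc k) (hole-vanish k le)))

chargeEnergy-widen : ∀ {S M c e} d → ChargeEnergy S M c e → ChargeEnergy S (d + M) c e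
chargeEnergy-widen {S} {M} d (bound , charge , energy) =
  DiracBound-widen {S} {M} bound d ,
  trans (chargeWithin-widen {S} {M} bound d) charge ,
  trans (cong +_ (energyWithin-widen {S} {M} bound d)) energy

chargeEnergy-unique : ∀ {S M₁ M₂ c₁ c₂ e₁ e₂} →
  ChargeEnergy S M₁ c₁ e₁ → ChargeEnergy S M₂ c₂ e₂ → c₁ ≡ c₂ × e₁ ≡ e₂
chargeEnergy-unique {S} {M₁} {M₂} ce₁ ce₂
  with chargeEnergy-widen {S} M₂ ce₁ | chargeEnergy-widen {S} M₁ ce₂
... | (_ , charge₁ , energy₁) | (_ , charge₂ , energy₂) rewrite +-comm M₁ M₂ =
  trans (sym charge₁) charge₂ , trans (sym energy₁) energy₂

infix 4 _∈Window_
data _∈Window_ : ℤ → ℕ → Set where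
  nonneg : ∀ {j M} → j < M → + j ∈Window M
  neg    : ∀ {j M} → j < M → -[1+ j ] ∈Window M

∈Window-outside : ∀ {p M k} → p ∈Window M → M ≤ k → + k ≢ p × -[1+ k ] ≢ p
∈Window-outside (nonneg j<M) M≤k = (λ { refl → <-irrefl refl (<-≤-trans j<M M≤k) }) , (λ ())
∈Window-outside (neg j<M)    M≤k = (λ ()) , (λ { refl → <-irrefl refl (<-≤-trans j<M M≤k) })

-M≤-[1+j]⇒j<M : ∀ {M j} → ℤ.- (+ M) ℤ.≤ -[1+ j ] → j < M
-M≤-[1+j]⇒j<M {suc M} (ℤ.-≤- j≤M) = s≤s j≤M

∈Window-intro : ∀ {p M} → ℤ.- (+ M) ℤ.≤ p → p ℤ.< + M → p ∈Window M
∈Window-intro {+ j}      _    j<M = nonneg (ℤ.drop‿+<+ j<M)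
∈Window-intro { -[1+ j ]} -M≤p _  = neg (-M≤-[1+j]⇒j<M -M≤p)

record Adjoins (p : ℤ) (S' S : ℤ → Bool) : Set where
  field
    present : S p ≡ true
    absent  : S' p ≡ false
    agree   : ∀ c → c ≢ p → S c ≡ S' c

module _ {S' S : ℤ → Bool} {M : ℕ} where

  private
    pos-suc-minus : ∀ a b → + (a + 1) ℤ.- + b ≡ (+ a ℤ.- + b) ℤ.+ 1ℤ
    pos-suc-minus a b rewrite ℤ.pos-+ a 1 = shift (+ a) (+ b)
      where shift : ∀ a b → (a ℤ.+ 1ℤ) ℤ.- b ≡ (a ℤ.- b) ℤ.+ 1ℤ
            shift = solve-∀

    neg-suc-minus : ∀ a b → + a ℤ.- + b ≡ (+ a ℤ.- + (b + 1)) ℤ.+ 1ℤ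
    neg-suc-minus a b rewrite ℤ.pos-+ b 1 = shift (+ a) (+ b)
      where shift : ∀ a b → a ℤ.- b ≡ (a ℤ.- (b ℤ.+ 1ℤ)) ℤ.+ 1ℤ
            shift = solve-∀

    pos-shuffle : ∀ a b j → + (a + j + b) ≡ + (a + b) ℤ.+ + j
    pos-shuffle a b j = trans (cong +_ (shuffle a b j)) (ℤ.pos-+ (a + b) j)
      where shuffle : ∀ a b j → a + j + b ≡ a + b + j
            shuffle = ℕ-Solver.solve-∀

    neg-shuffle : ∀ a b j → + (a + b) ≡ + (a + (b + suc j)) ℤ.+ -[1+ j ]
    neg-shuffle a b j rewrite sym (+-assoc a b (suc j)) | ℤ.pos-+ (a + b) (suc j) =
      cancel (+ (a + b)) (+ suc j)
      where cancel : ∀ x s → x ≡ (x ℤ.+ s) ℤ.+ ℤ.- s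
            cancel = solve-∀

  chargeEnergyWithin-addParticle : ∀ {j} → Adjoins (+ j) S' S → j < M →
    chargeWithin S M ≡ chargeWithin S' M ℤ.+ 1ℤ × + energyWithin S M ≡ + energyWithin S' M ℤ.+ + j
  chargeEnergyWithin-addParticle {j} adj j<M = charge , energy
    where
    open Adjoins adj
    elsewhere : ∀ {f : ℕ → Bool → ℕ} i → i ≢ j → f i (S (+ i)) ≡ f i (S' (+ i))
    elsewhere {f} i i≢j = cong (f i) (agree (+ i) (i≢j ∘ ℤ.+-injective))
    holes : ∀ (f : Bool → ℕ) k → f (S -[1+ k ]) ≡ f (S' -[1+ k ])
    holes f k = cong f (agree -[1+ k ] (λ ()))
    particle-bump : particleAt S j ≡ particleAt S' j + 1
    particle-bump rewrite present | absent = refl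
    energy-bump : particleAt S j * j ≡ particleAt S' j * j + j
    energy-bump rewrite present | absent = +-identityʳ j
    charge : chargeWithin S M ≡ chargeWithin S' M ℤ.+ 1ℤ
    charge = trans
      (cong₂ (λ a b → + a ℤ.- + b)
        (∑<-bump M j<M (elsewhere {λ _ → ind}) particle-bump)
        (∑<-cong M (λ k _ → holes (ind ∘ not) k)))
      (pos-suc-minus (∑< M (particleAt S')) (∑< M (holeAt S')))
    energy : + energyWithin S M ≡ + energyWithin S' M ℤ.+ + j
    energy = trans
      (cong₂ (λ a b → + (a + b))
        (∑<-bump M j<M (elsewhere {λ i b → ind b * i}) energy-bump)
        (∑<-cong M (λ k _ → holes (λ b → ind (not b) * suc k) k)))
      (pos-shuffle (∑< M (λ k → particleAt S' k * k)) (∑< M (λ k → holeAt S' k * suc k)) j)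

  chargeEnergyWithin-fillHole : ∀ {j} → Adjoins -[1+ j ] S' S → j < M →
    chargeWithin S M ≡ chargeWithin S' M ℤ.+ 1ℤ × + energyWithin S M ≡ + energyWithin S' M ℤ.+ -[1+ j ]
  chargeEnergyWithin-fillHole {j} adj j<M = charge , energy
    where
    open Adjoins adj
    elsewhere : ∀ {f : ℕ → Bool → ℕ} i → i ≢ j → f i (S' -[1+ i ]) ≡ f i (S -[1+ i ])
    elsewhere {f} i i≢j = cong (f i) (sym (agree -[1+ i ] (i≢j ∘ ℤ.-[1+-injective)))
    particles : ∀ (f : Bool → ℕ) k → f (S (+ k)) ≡ f (S' (+ k))
    particles f k = cong f (agree (+ k) (λ ()))
    hole-bump : holeAt S' j ≡ holeAt S j + 1
    hole-bump rewrite present | absent = refl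
    energy-bump : holeAt S' j * suc j ≡ holeAt S j * suc j + suc j
    energy-bump rewrite present | absent = +-identityʳ (suc j)
    charge : chargeWithin S M ≡ chargeWithin S' M ℤ.+ 1ℤ
    charge = trans
      (neg-suc-minus (∑< M (particleAt S)) (∑< M (holeAt S)))
      (cong₂ (λ a b → (+ a ℤ.- + b) ℤ.+ 1ℤ)
        (∑<-cong M (λ k _ → particles ind k))
        (sym (∑<-bump M j<M (elsewhere {λ _ → ind ∘ not}) hole-bump)))
    energy : + energyWithin S M ≡ + energyWithin S' M ℤ.+ -[1+ j ]
    energy = trans
      (neg-shuffle (∑< M (λ k → particleAt S k * k)) (∑< M (λ k → holeAt S k * suc k)) j)
      (cong₂ (λ a b → + (a + b) ℤ.+ -[1+ j ])
        (∑<-cong M (λ k _ → particles (λ b → ind b * k) k))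
        (sym (∑<-bump M j<M (elsewhere {λ i b → ind (not b) * suc i}) energy-bump)))

  chargeEnergyWithin-adjoin : ∀ {p} → Adjoins p S' S → p ∈Window M →
    chargeWithin S M ≡ chargeWithin S' M ℤ.+ 1ℤ × + energyWithin S M ≡ + energyWithin S' M ℤ.+ p
  chargeEnergyWithin-adjoin adj (nonneg j<M) = chargeEnergyWithin-addParticle adj j<M
  chargeEnergyWithin-adjoin adj (neg j<M)    = chargeEnergyWithin-fillHole adj j<M

module _ {p S' S M} (adj : Adjoins p S' S) (p∈ : p ∈Window M) where

  open Adjoins adj

  DiracBound-adjoin : DiracBound S' M → DiracBound S M
  DiracBound-adjoin (above , below) =
    (λ k M≤k → trans (agree _ (proj₁ (∈Window-outside p∈ M≤k))) (above k M≤k)) ,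
    (λ k M≤k → trans (agree _ (proj₂ (∈Window-outside p∈ M≤k))) (below k M≤k))

  DiracBound-remove : DiracBound S M → DiracBound S' M
  DiracBound-remove (above , below) =
    (λ k M≤k → trans (sym (agree _ (proj₁ (∈Window-outside p∈ M≤k)))) (above k M≤k)) ,
    (λ k M≤k → trans (sym (agree _ (proj₂ (∈Window-outside p∈ M≤k)))) (below k M≤k))

  chargeEnergy-adjoin : ∀ {c e} → ChargeEnergy S' M c e → ChargeEnergy S M (c ℤ.+ 1ℤ) (e ℤ.+ p)
  chargeEnergy-adjoin (bound , refl , refl) =
    DiracBound-adjoin bound , chargeEnergyWithin-adjoin adj p∈

  chargeEnergy-remove : ∀ {c e} → ChargeEnergy S M c e → ChargeEnergy S' M (c ℤ.- 1ℤ) (e ℤ.- p)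
  chargeEnergy-remove (bound , refl , refl) =
    DiracBound-remove bound ,
    trans (cancel _ 1ℤ) (cong (ℤ._- 1ℤ) (sym charge)) ,
    trans (cancel _ p) (cong (ℤ._- p) (sym energy))
    where
    charge = proj₁ (chargeEnergyWithin-adjoin adj p∈)
    energy = proj₂ (chargeEnergyWithin-adjoin adj p∈)
    cancel : ∀ x s → x ≡ (x ℤ.+ s) ℤ.- s
    cancel = solve-∀

triangle : ℕ → ℕ
triangle zero    = 0
triangle (suc k) = triangle k + k

triangle-double : ∀ k → triangle (suc k) * 2 ≡ suc k * k
triangle-double zero    = refl
triangle-double (suc k) = begin
  (triangle (suc k) + suc k) * 2    ≡⟨ ℕ.*-distribʳ-+ 2 (triangle (suc k)) (suc k) ⟩
  triangle (suc k) * 2 + suc k * 2  ≡⟨ cong (_+ suc k * 2) (triangle-double k) ⟩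
  suc k * k + suc k * 2             ≡⟨ expand k ⟩
  suc (suc k) * suc k               ∎
  where open ≡-Reasoning
        expand : ∀ k → suc k * k + suc k * 2 ≡ suc (suc k) * suc k
        expand = ℕ-Solver.solve-∀

tri-nonneg : ∀ k → tri (+ k) ≡ triangle k
tri-nonneg zero    = refl
tri-nonneg (suc k) = begin
  ℤ.∣ + suc k ℤ.* + k ∣ / 2    ≡⟨ cong (_/ 2) (ℤ.abs-* (+ suc k) (+ k)) ⟩
  suc k * k / 2                ≡⟨ cong (_/ 2) (triangle-double k) ⟨
  triangle (suc k) * 2 / 2     ≡⟨ m*n/n≡m (triangle (suc k)) 2 ⟩
  triangle (suc k)             ∎
  where open ≡-Reasoning

tri-neg : ∀ k → tri -[1+ k ] ≡ triangle (suc (suc k))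
tri-neg k = begin
  ℤ.∣ -[1+ k ] ℤ.* -[1+ suc (k + 0) ] ∣ / 2  ≡⟨ cong (_/ 2) (ℤ.abs-* -[1+ k ] -[1+ suc (k + 0) ]) ⟩
  suc k * suc (suc (k + 0)) / 2              ≡⟨ cong (λ m → suc k * suc (suc m) / 2) (+-identityʳ k) ⟩
  suc k * suc (suc k) / 2                    ≡⟨ cong (_/ 2) (ℕ.*-comm (suc k) (suc (suc k))) ⟩
  suc (suc k) * suc k / 2                    ≡⟨ cong (_/ 2) (triangle-double (suc k)) ⟨
  triangle (suc (suc k)) * 2 / 2             ≡⟨ m*n/n≡m (triangle (suc (suc k))) 2 ⟩
  triangle (suc (suc k))                     ∎
  where open ≡-Reasoning

tri-suc : ∀ z → + tri (z ℤ.+ 1ℤ) ≡ + tri z ℤ.+ z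
tri-suc (+ k) rewrite +-comm k 1 | tri-nonneg (suc k) | tri-nonneg k = ℤ.pos-+ (triangle k) k
tri-suc -[1+ zero ]  = refl
tri-suc -[1+ suc k ] rewrite tri-neg k | tri-neg (suc k) = begin
  + t                                      ≡⟨ cancel (+ t) (+ suc (suc k)) ⟩
  + t ℤ.+ + suc (suc k) ℤ.+ -[1+ suc k ]   ≡⟨ cong (ℤ._+ -[1+ suc k ]) (ℤ.pos-+ t (suc (suc k))) ⟨
  + (t + suc (suc k)) ℤ.+ -[1+ suc k ]     ∎
  where
  open ≡-Reasoning
  t = triangle (suc (suc k))
  cancel : ∀ x s → x ≡ (x ℤ.+ s) ℤ.+ ℤ.- s
  cancel = solve-∀

data Column : Set where
  E X Y : Column

isX isY filled : Column → Bool
isX X = true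
isX _ = false
isY Y = true
isY _ = false
filled s = isX s ∨ isY s

toVSet : (ℤ → Column) → VSet
toVSet f (x c) = isX (f c)
toVSet f (y c) = isY (f c)

columnOf : VSet → ℤ → Column
columnOf χ c = if χ (x c) then X else if χ (y c) then Y else E

columnOf-toVSet : ∀ f c → columnOf (toVSet f) c ≡ f c
columnOf-toVSet f c = recovers (f c)
  where
  recovers : ∀ s → (if isX s then X else if isY s then Y else E) ≡ s
  recovers E = refl
  recovers X = refl
  recovers Y = refl

columnOf-cong : ∀ {χ ψ} → χ ≈ ψ → ∀ c → columnOf χ c ≡ columnOf ψ c
columnOf-cong χ≈ψ c = cong₂ (λ a b → if a then X else if b then Y else E) (χ≈ψ (x c)) (χ≈ψ (y c))

toVSet-injective : ∀ {f g} → toVSet f ≈ toVSet g → ∀ c → f c ≡ g c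
toVSet-injective {f} {g} f≈g c =
  trans (sym (columnOf-toVSet f c)) (trans (columnOf-cong f≈g c) (columnOf-toVSet g c))

columnOf-X : ∀ χ {c} → columnOf χ c ≡ X → χ (x c) ≡ true
columnOf-X χ {c} eq with χ (x c) | χ (y c)
columnOf-X χ refl | true  | _     = refl
columnOf-X χ ()   | false | true
columnOf-X χ ()   | false | false

columnOf-Y : ∀ χ {c} → columnOf χ c ≡ Y → χ (y c) ≡ true
columnOf-Y χ {c} eq with χ (x c) | χ (y c)
columnOf-Y χ ()   | true  | _
columnOf-Y χ refl | false | true  = refl
columnOf-Y χ ()   | false | false

columnOf-empty : ∀ χ {c} → Ω χ c ≡ false → columnOf χ c ≡ E
columnOf-empty χ {c} empty with χ (x c) | χ (y c)
columnOf-empty χ refl | false | false = refl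

toVSet-columnOf : ∀ {χ} → IsConfiguration χ → toVSet (columnOf χ) ≈ χ
toVSet-columnOf {χ} conf (x c) with χ (x c) | χ (y c)
... | true  | _     = refl
... | false | true  = refl
... | false | false = refl
toVSet-columnOf {χ} conf (y c) with χ (x c) in x-filled | χ (y c) in y-filled
... | true  | true  = ⊥-elim (conf (rung c) (x-filled , y-filled))
... | true  | false = refl
... | false | true  = refl
... | false | false = refl

toVSet-cong : ∀ {f g} → (∀ c → f c ≡ g c) → toVSet f ≈ toVSet g
toVSet-cong f≗g (x c) = cong isX (f≗g c)
toVSet-cong f≗g (y c) = cong isY (f≗g c)

Ω-cong : ∀ {χ ψ} → χ ≈ ψ → ∀ c → Ω χ c ≡ Ω ψ c
Ω-cong χ≈ψ c = cong₂ _∨_ (χ≈ψ (x c)) (χ≈ψ (y c))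

filledAt : (ℤ → Column) → ℤ → Bool
filledAt f c = filled (f c)

cell : List Column → ℕ → Column
cell []      k       = E
cell (s ∷ w) zero    = s
cell (s ∷ w) (suc k) = cell w k

relative : List Column → ℤ → Column
relative w (+ k)    = cell w k
relative w -[1+ _ ] = Y

-- The word w written from column p on: the tail type T to its left, empty columns to its right.
place : ℤ → List Column → ℤ → Column
place p w c = relative w (c ℤ.- p)

relative-drop : ∀ w {z} → z ≢ + 0 → relative w z ≡ relative (drop 1 w) (z ℤ.- 1ℤ)
relative-drop w       {+ zero}   z≢0 = ⊥-elim (z≢0 refl)
relative-drop []      {+ suc k}  _   = refl
relative-drop (s ∷ w) {+ suc k}  _   = refl
relative-drop w       { -[1+ k ]} _   = refl

place-drop : ∀ p w {c} → c ≢ p → place p w c ≡ place (p ℤ.+ 1ℤ) (drop 1 w) c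
place-drop p w {c} c≢p =
  trans (relative-drop w (c≢p ∘ ℤ.i-j≡0⇒i≡j c p)) (cong (relative (drop 1 w)) (sym (reassoc c p)))
  where reassoc : ∀ c p → c ℤ.- (p ℤ.+ 1ℤ) ≡ (c ℤ.- p) ℤ.- 1ℤ
        reassoc = solve-∀

place-origin : ∀ p w → place p w p ≡ cell w 0
place-origin p w rewrite ℤ.+-inverseʳ p = refl

place-left : ∀ p w {c} → c ℤ.< p → place p w c ≡ Y
place-left p w {c} c<p with c ℤ.- p | c-p<0
  where c-p<0 : c ℤ.- p ℤ.< 0ℤ
        c-p<0 = subst (c ℤ.- p ℤ.<_) (ℤ.+-inverseʳ p) (ℤ.+-monoˡ-< (ℤ.- p) c<p)
... | -[1+ _ ] | _ = refl
... | + _ | ℤ.+<+ ()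

i<i+1 : ∀ i → i ℤ.< i ℤ.+ 1ℤ
i<i+1 i = ℤ.suc[i]≤j⇒i<j (ℤ.≤-reflexive (ℤ.+-comm 1ℤ i))

place-origin-left : ∀ p w → place (p ℤ.+ 1ℤ) w p ≡ Y
place-origin-left p w = place-left (p ℤ.+ 1ℤ) w (i<i+1 p)

place-origin-Y : ∀ p w c → place p (Y ∷ w) c ≡ place (p ℤ.+ 1ℤ) w c
place-origin-Y p w c with c ℤ.≟ p
... | yes refl = trans (place-origin c (Y ∷ w)) (sym (place-origin-left c w))
... | no c≢p   = place-drop p (Y ∷ w) c≢p

place-run : ∀ k p w c → place p (replicate k Y ++ w) c ≡ place (p ℤ.+ + k) w c
place-run zero    p w c = cong (λ q → place q w c) (sym (ℤ.+-identityʳ p))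
place-run (suc k) p w c = begin
  place p (Y ∷ replicate k Y ++ w) c       ≡⟨ place-origin-Y p (replicate k Y ++ w) c ⟩
  place (p ℤ.+ 1ℤ) (replicate k Y ++ w) c  ≡⟨ place-run k (p ℤ.+ 1ℤ) w c ⟩
  place (p ℤ.+ 1ℤ ℤ.+ + k) w c             ≡⟨ cong (λ q → place q w c) (ℤ.+-assoc p 1ℤ (+ k)) ⟩
  place (p ℤ.+ + suc k) w c                ∎
  where open ≡-Reasoning

place-right : ∀ p {c} → p ℤ.≤ c → place p [] c ≡ E
place-right p {c} p≤c with c ℤ.- p | 0≤c-p
  where 0≤c-p : 0ℤ ℤ.≤ c ℤ.- p
        0≤c-p = subst (ℤ._≤ c ℤ.- p) (ℤ.+-inverseʳ p) (ℤ.+-monoˡ-≤ (ℤ.- p) p≤c)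
... | + _ | _ = refl

-- The Dirac sea and placed words

module _ (p : ℤ) (w : List Column) where

  adjoin-origin : cell w 0 ≡ E →
    Adjoins p (filledAt (place p w)) (filledAt (place (p ℤ.+ 1ℤ) (drop 1 w)))
  adjoin-origin origin-empty = record
    { present = cong filled (place-origin-left p (drop 1 w))
    ; absent  = cong filled (trans (place-origin p w) origin-empty)
    ; agree   = λ c c≢p → cong filled (sym (place-drop p w c≢p))
    }

  filledAt-origin : filled (cell w 0) ≡ true →
    ∀ c → filledAt (place p w) c ≡ filledAt (place (p ℤ.+ 1ℤ) (drop 1 w)) c
  filledAt-origin origin-filled c with c ℤ.≟ p
  ... | yes refl = trans (cong filled (place-origin c w))
                     (trans origin-filled (cong filled (sym (place-origin-left c (drop 1 w)))))
  ... | no c≢p   = cong filled (place-drop p w c≢p)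

sea : ℤ → ℤ → Bool
sea p = filledAt (place p [])

module _ {M : ℕ} where

  SeaChargeEnergy : ℤ → Set
  SeaChargeEnergy p = ChargeEnergy (sea p) M p (+ tri p)

  sea-up : ∀ {p} → p ∈Window M → SeaChargeEnergy p → SeaChargeEnergy (p ℤ.+ 1ℤ)
  sea-up {p} p∈ ce = subst (ChargeEnergy (sea (p ℤ.+ 1ℤ)) M (p ℤ.+ 1ℤ)) (sym (tri-suc p))
    (chargeEnergy-adjoin (adjoin-origin p [] refl) p∈ ce)

  sea-down : ∀ {p} → p ∈Window M → SeaChargeEnergy (p ℤ.+ 1ℤ) → SeaChargeEnergy p
  sea-down {p} p∈ ce =
    subst₂ (ChargeEnergy (sea p) M) (undo p 1ℤ) (trans (cong (ℤ._- p) (tri-suc p)) (undo (+ tri p) p))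
      (chargeEnergy-remove (adjoin-origin p [] refl) p∈ ce)
    where undo : ∀ t p → (t ℤ.+ p) ℤ.- p ≡ t
          undo = solve-∀

  sea-empty : SeaChargeEnergy 0ℤ
  sea-empty = ((λ _ _ → refl) , (λ _ _ → refl)) ,
    cong₂ (λ a b → + a ℤ.- + b) (∑<-zero M) (∑<-zero M) ,
    cong +_ (cong₂ _+_ (∑<-zero M) (∑<-zero M))

  sea-nonneg : ∀ j → j ≤ M → SeaChargeEnergy (+ j)
  sea-nonneg zero    _   = sea-empty
  sea-nonneg (suc j) j<M = subst SeaChargeEnergy (cong +_ (+-comm j 1))
    (sea-up (nonneg j<M) (sea-nonneg j (ℕ.<⇒≤ j<M)))

  sea-neg : ∀ j → j < M → SeaChargeEnergy -[1+ j ]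
  sea-neg zero    j<M = sea-down (neg j<M) sea-empty
  sea-neg (suc j) j<M = sea-down (neg j<M) (sea-neg j (ℕ.<⇒≤ j<M))

  sea-chargeEnergy : ∀ {p} → ℤ.- (+ M) ℤ.≤ p → p ℤ.≤ + M → SeaChargeEnergy p
  sea-chargeEnergy {+ j}      _     j≤M = sea-nonneg j (ℤ.drop‿+≤+ j≤M)
  sea-chargeEnergy { -[1+ j ]} -M≤p _   = sea-neg j (-M≤-[1+j]⇒j<M -M≤p)

wordCharge : ℤ → List Column → ℤ
wordCharge p []      = p
wordCharge p (E ∷ w) = wordCharge (p ℤ.+ 1ℤ) w ℤ.- 1ℤ
wordCharge p (X ∷ w) = wordCharge (p ℤ.+ 1ℤ) w
wordCharge p (Y ∷ w) = wordCharge (p ℤ.+ 1ℤ) w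

wordEnergy : ℤ → List Column → ℤ
wordEnergy p []      = + tri p
wordEnergy p (E ∷ w) = wordEnergy (p ℤ.+ 1ℤ) w ℤ.- p
wordEnergy p (X ∷ w) = wordEnergy (p ℤ.+ 1ℤ) w
wordEnergy p (Y ∷ w) = wordEnergy (p ℤ.+ 1ℤ) w

place-chargeEnergy : ∀ {M} w p → ℤ.- (+ M) ℤ.≤ p → p ℤ.+ + length w ℤ.≤ + M →
  ChargeEnergy (filledAt (place p w)) M (wordCharge p w) (wordEnergy p w)
place-chargeEnergy {M} [] p -M≤p p≤M =
  sea-chargeEnergy -M≤p (subst (ℤ._≤ + M) (ℤ.+-identityʳ p) p≤M)
place-chargeEnergy {M} (s ∷ w) p -M≤p end≤M = extend s
  where
  p+1≤end : p ℤ.+ 1ℤ ℤ.≤ p ℤ.+ + length (s ∷ w)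
  p+1≤end = ℤ.+-monoʳ-≤ p (ℤ.+≤+ (s≤s z≤n))
  p∈ : p ∈Window M
  p∈ = ∈Window-intro -M≤p (ℤ.<-≤-trans (ℤ.<-≤-trans (i<i+1 p) p+1≤end) end≤M)
  rest : ChargeEnergy (filledAt (place (p ℤ.+ 1ℤ) w)) M
           (wordCharge (p ℤ.+ 1ℤ) w) (wordEnergy (p ℤ.+ 1ℤ) w)
  rest = place-chargeEnergy w (p ℤ.+ 1ℤ) (ℤ.≤-trans -M≤p (ℤ.i≤i+j p 1ℤ))
    (subst (ℤ._≤ + M) (sym (ℤ.+-assoc p 1ℤ (+ length w))) end≤M)
  extend : ∀ s → ChargeEnergy (filledAt (place p (s ∷ w))) M (wordCharge p (s ∷ w)) (wordEnergy p (s ∷ w))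
  extend E = chargeEnergy-remove (adjoin-origin p (E ∷ w) refl) p∈ rest
  extend X = chargeEnergy-cong (λ c → sym (filledAt-origin p (X ∷ w) refl c)) rest
  extend Y = chargeEnergy-cong (λ c → sym (filledAt-origin p (Y ∷ w) refl c)) rest

enclosingWindow : ∀ p L → ∃[ M ] (ℤ.- (+ M) ℤ.≤ p × p ℤ.+ + L ℤ.≤ + M)
enclosingWindow (+ j)    L = j + L , ℤ.neg-≤-pos , ℤ.≤-refl
enclosingWindow -[1+ j ] L = suc j + L , ℤ.-≤- (m≤m+n j L) ,
  ℤ.≤-trans (ℤ.m⊖n≤m L (suc j)) (ℤ.+≤+ (m≤n+m L (suc j)))

-- Codes

-- A part (true , r) stands for a run of r + 1 particles on x, a part (false , r) for a
-- run of r particles on y; in a code word every run is preceded by an empty column.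
Part : Set
Part = Bool × ℕ

partSize : Part → ℕ
partSize (true  , r) = suc r
partSize (false , r) = r

letter : Bool → Column
letter true  = X
letter false = Y

segment : Part → List Column
segment (b , r) = E ∷ replicate (partSize (b , r)) (letter b)

codeWord : List Part → List Column
codeWord []      = []
codeWord (h ∷ d) = segment h ++ codeWord d

codeSize : List Part → ℕ
codeSize []      = 0
codeSize (h ∷ d) = partSize h + codeSize d

-- The i-th part of a code (counting from 1) contributes i · partSize to its energy.
codeEnergy : List Part → ℕ
codeEnergy []      = 0
codeEnergy (h ∷ d) = partSize h + codeEnergy d + codeSize d

∅ : Part
∅ = false , 0

wordCharge-run : ∀ b n p w → wordCharge p (replicate n (letter b) ++ w) ≡ wordCharge (p ℤ.+ + n) w
wordCharge-run b     zero    p w = cong (λ q → wordCharge q w) (sym (ℤ.+-identityʳ p))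
wordCharge-run true  (suc n) p w =
  trans (wordCharge-run true n (p ℤ.+ 1ℤ) w) (cong (λ q → wordCharge q w) (ℤ.+-assoc p 1ℤ (+ n)))
wordCharge-run false (suc n) p w =
  trans (wordCharge-run false n (p ℤ.+ 1ℤ) w) (cong (λ q → wordCharge q w) (ℤ.+-assoc p 1ℤ (+ n)))

wordEnergy-run : ∀ b n p w → wordEnergy p (replicate n (letter b) ++ w) ≡ wordEnergy (p ℤ.+ + n) w
wordEnergy-run b     zero    p w = cong (λ q → wordEnergy q w) (sym (ℤ.+-identityʳ p))
wordEnergy-run true  (suc n) p w =
  trans (wordEnergy-run true n (p ℤ.+ 1ℤ) w) (cong (λ q → wordEnergy q w) (ℤ.+-assoc p 1ℤ (+ n)))
wordEnergy-run false (suc n) p w =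
  trans (wordEnergy-run false n (p ℤ.+ 1ℤ) w) (cong (λ q → wordEnergy q w) (ℤ.+-assoc p 1ℤ (+ n)))

wordCharge-codeWord : ∀ d p → wordCharge p (codeWord d) ≡ p ℤ.+ + codeSize d
wordCharge-codeWord []            p = sym (ℤ.+-identityʳ p)
wordCharge-codeWord ((b , r) ∷ d) p = begin
  wordCharge (p ℤ.+ 1ℤ) (replicate m (letter b) ++ codeWord d) ℤ.- 1ℤ
    ≡⟨ cong (ℤ._- 1ℤ) (wordCharge-run b m (p ℤ.+ 1ℤ) (codeWord d)) ⟩
  wordCharge (p ℤ.+ 1ℤ ℤ.+ + m) (codeWord d) ℤ.- 1ℤ
    ≡⟨ cong (ℤ._- 1ℤ) (wordCharge-codeWord d _) ⟩
  p ℤ.+ 1ℤ ℤ.+ + m ℤ.+ + codeSize d ℤ.- 1ℤ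
    ≡⟨ regroup p (+ m) (+ codeSize d) ⟩
  p ℤ.+ (+ m ℤ.+ + codeSize d)
    ≡⟨ cong (ℤ._+_ p) (ℤ.pos-+ m (codeSize d)) ⟨
  p ℤ.+ + (m + codeSize d) ∎
  where
  open ≡-Reasoning
  m = partSize (b , r)
  regroup : ∀ p m s → p ℤ.+ 1ℤ ℤ.+ m ℤ.+ s ℤ.- 1ℤ ≡ p ℤ.+ (m ℤ.+ s)
  regroup = solve-∀

wordEnergy-codeWord : ∀ d p → wordEnergy p (codeWord d) ≡ + tri (p ℤ.+ + codeSize d) ℤ.+ + codeEnergy d
wordEnergy-codeWord []            p =
  trans (cong (λ q → + tri q) (sym (ℤ.+-identityʳ p))) (sym (ℤ.+-identityʳ _))
wordEnergy-codeWord ((b , r) ∷ d) p = begin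
  wordEnergy (p ℤ.+ 1ℤ) (replicate m (letter b) ++ codeWord d) ℤ.- p
    ≡⟨ cong (ℤ._- p) (wordEnergy-run b m (p ℤ.+ 1ℤ) (codeWord d)) ⟩
  wordEnergy (p ℤ.+ 1ℤ ℤ.+ + m) (codeWord d) ℤ.- p
    ≡⟨ cong (ℤ._- p) (wordEnergy-codeWord d _) ⟩
  + tri (p ℤ.+ 1ℤ ℤ.+ + m ℤ.+ + s) ℤ.+ + en ℤ.- p
    ≡⟨ cong (λ z → + tri z ℤ.+ + en ℤ.- p) (regroup p (+ m) (+ s)) ⟩
  + tri (q ℤ.+ 1ℤ) ℤ.+ + en ℤ.- p
    ≡⟨ cong (λ z → z ℤ.+ + en ℤ.- p) (tri-suc q) ⟩
  + tri q ℤ.+ q ℤ.+ + en ℤ.- p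
    ≡⟨ collect p (+ m) (+ s) (+ tri q) (+ en) ⟩
  + tri q ℤ.+ (+ m ℤ.+ + en ℤ.+ + s)
    ≡⟨ cong₂ (λ a e → + tri a ℤ.+ e) (cong (ℤ._+_ p) (ℤ.pos-+ m s))
         (trans (cong (ℤ._+ + s) (ℤ.pos-+ m en)) (ℤ.pos-+ (m + en) s)) ⟨
  + tri (p ℤ.+ + (m + s)) ℤ.+ + (m + en + s) ∎
  where
  open ≡-Reasoning
  m = partSize (b , r)
  s = codeSize d
  en = codeEnergy d
  q = p ℤ.+ (+ m ℤ.+ + s)
  regroup : ∀ p m s → p ℤ.+ 1ℤ ℤ.+ m ℤ.+ s ≡ p ℤ.+ (m ℤ.+ s) ℤ.+ 1ℤ
  regroup = solve-∀
  collect : ∀ p m s t e → t ℤ.+ (p ℤ.+ (m ℤ.+ s)) ℤ.+ e ℤ.- p ≡ t ℤ.+ (m ℤ.+ e ℤ.+ s)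
  collect = solve-∀

codeSize-++ : ∀ d e → codeSize (d ++ e) ≡ codeSize d + codeSize e
codeSize-++ []      e = refl
codeSize-++ (h ∷ d) e = trans (cong (_+_ (partSize h)) (codeSize-++ d e)) (sym (+-assoc (partSize h) _ _))

codeEnergy-++ : ∀ d e → codeEnergy (d ++ e) ≡ codeEnergy d + codeEnergy e + length d * codeSize e
codeEnergy-++ []      e = sym (+-identityʳ (codeEnergy e))
codeEnergy-++ (h ∷ d) e
  rewrite codeEnergy-++ d e | codeSize-++ d e =
  regroup (partSize h) (codeEnergy d) (codeEnergy e) (codeSize d) (codeSize e) (length d)
  where
  regroup : ∀ m a b s t l → m + (a + b + l * t) + (s + t) ≡ m + a + s + b + suc l * t
  regroup = ℕ-Solver.solve-∀

codeEnergy-∷ʳ : ∀ d h → codeEnergy (d ∷ʳ h) ≡ codeEnergy d + suc (length d) * partSize h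
codeEnergy-∷ʳ d h rewrite codeEnergy-++ d [ h ] = regroup (codeEnergy d) (partSize h) (length d)
  where
  regroup : ∀ a m l → a + (m + 0 + 0) + l * (m + 0) ≡ a + suc l * m
  regroup = ℕ-Solver.solve-∀

codeWord-++ : ∀ d e → codeWord (d ++ e) ≡ codeWord d ++ codeWord e
codeWord-++ []      e = refl
codeWord-++ (h ∷ d) e = trans (cong (segment h ++_) (codeWord-++ d e)) (sym (++-assoc (segment h) _ _))

codeSize-empties : ∀ k → codeSize (replicate k ∅) ≡ 0
codeSize-empties zero    = refl
codeSize-empties (suc k) = codeSize-empties k

codeEnergy-empties : ∀ k → codeEnergy (replicate k ∅) ≡ 0
codeEnergy-empties zero    = refl
codeEnergy-empties (suc k) = cong₂ _+_ (codeEnergy-empties k) (codeSize-empties k)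

codeWord-empties : ∀ k → codeWord (replicate k ∅) ≡ replicate k E
codeWord-empties zero    = refl
codeWord-empties (suc k) = cong (E ∷_) (codeWord-empties k)

cell-++-empty : ∀ w k i → cell (w ++ replicate k E) i ≡ cell w i
cell-++-empty []      zero    i       = refl
cell-++-empty []      (suc k) zero    = refl
cell-++-empty []      (suc k) (suc i) = cell-++-empty [] k i
cell-++-empty (s ∷ w) k       zero    = refl
cell-++-empty (s ∷ w) k       (suc i) = cell-++-empty w k i

relative-++-empty : ∀ w k z → relative (w ++ replicate k E) z ≡ relative w z
relative-++-empty w k (+ i)      = cell-++-empty w k i
relative-++-empty w k -[1+ _ ]   = refl

length-codeWord : ∀ d → length (codeWord d) ≡ length d + codeSize d
length-codeWord []            = refl
length-codeWord ((b , r) ∷ d) = cong suc (begin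
  length (replicate m (letter b) ++ codeWord d)
    ≡⟨ length-++ (replicate m (letter b)) ⟩
  length (replicate m (letter b)) + length (codeWord d)
    ≡⟨ cong₂ _+_ (length-replicate m) (length-codeWord d) ⟩
  m + (length d + codeSize d)
    ≡⟨ swap m (length d) (codeSize d) ⟩
  length d + (m + codeSize d) ∎)
  where
  open ≡-Reasoning
  m = partSize (b , r)
  swap : ∀ a b c → a + (b + c) ≡ b + (a + c)
  swap = ℕ-Solver.solve-∀

codeWord-origin : ∀ d → cell (codeWord d) 0 ≡ E
codeWord-origin []      = refl
codeWord-origin (h ∷ d) = refl

clash : Column → Column → Bool
clash X Y = true
clash Y X = true
clash _ _ = false

Compatible : Column → Column → Set
Compatible s t = clash s t ≡ false

compatible-E : ∀ s → Compatible s E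
compatible-E E = refl
compatible-E X = refl
compatible-E Y = refl

compatible-letter : ∀ b → Compatible (letter b) (letter b)
compatible-letter true  = refl
compatible-letter false = refl

cell-compatible : ∀ {w} → Linked Compatible w → ∀ k → Compatible (cell w k) (cell w (suc k))
cell-compatible []                 k       = refl
cell-compatible {s ∷ []} [-]       zero    = compatible-E s
cell-compatible [-]                (suc k) = refl
cell-compatible (st ∷ _)           zero    = st
cell-compatible (_ ∷ linked)       (suc k) = cell-compatible linked k

relative-compatible : ∀ {w} → Linked Compatible (Y ∷ w) →
  ∀ z → Compatible (relative w z) (relative w (z ℤ.+ 1ℤ))
relative-compatible _        -[1+ suc k ] = refl
relative-compatible [-]      -[1+ zero ]  = refl
relative-compatible (st ∷ _) -[1+ zero ]  = st
relative-compatible linked   (+ k) rewrite +-comm k 1 = cell-compatible (Linked.tail linked) k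

place-compatible : ∀ p {w} → Linked Compatible (Y ∷ w) →
  ∀ c → Compatible (place p w c) (place p w (c ℤ.+ 1ℤ))
place-compatible p {w} linked c =
  subst (Compatible (place p w c) ∘ relative w) (sym (shift c p)) (relative-compatible linked (c ℤ.- p))
  where
  shift : ∀ c p → (c ℤ.+ 1ℤ) ℤ.- p ≡ (c ℤ.- p) ℤ.+ 1ℤ
  shift = solve-∀

true≢false : true ≢ false
true≢false ()

false≢true : false ≢ true
false≢true ()

isX⇒X : ∀ {s} → isX s ≡ true → s ≡ X
isX⇒X {X} _ = refl

isY⇒Y : ∀ {s} → isY s ≡ true → s ≡ Y
isY⇒Y {Y} _ = refl

toVSet-isConfiguration : ∀ f → (∀ c → Compatible (f c) (f (c ℤ.+ 1ℤ))) → IsConfiguration (toVSet f)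
toVSet-isConfiguration f compatible (rung i)  (atX , atY) =
  false≢true (subst (λ s → isY s ≡ true) (isX⇒X atX) atY)
toVSet-isConfiguration f compatible (diag₁ i) (atX , atY) =
  true≢false (subst₂ (λ s t → clash s t ≡ false) (isX⇒X atX) (isY⇒Y atY) (compatible i))
toVSet-isConfiguration f compatible (diag₂ i) (atX , atY) =
  true≢false (subst₂ (λ s t → clash s t ≡ false) (isY⇒Y atY) (isX⇒X atX) (compatible i))
toVSet-isConfiguration f compatible (sym-e e) (v , w) = toVSet-isConfiguration f compatible e (w , v)

columnOf-compatible : ∀ {χ} → IsConfiguration χ →
  ∀ c → Compatible (columnOf χ c) (columnOf χ (c ℤ.+ 1ℤ))
columnOf-compatible {χ} conf c with columnOf χ c in here | columnOf χ (c ℤ.+ 1ℤ) in next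
... | X | Y = ⊥-elim (conf (diag₁ c) (columnOf-X χ here , columnOf-Y χ next))
... | Y | X = ⊥-elim (conf (diag₂ c) (columnOf-X χ next , columnOf-Y χ here))
... | E | _ = refl
... | X | X = refl
... | X | E = refl
... | Y | Y = refl
... | Y | E = refl

codeWord-linked : ∀ s d → Linked Compatible (s ∷ codeWord d)
run-linked      : ∀ b n d → Linked Compatible (letter b ∷ replicate n (letter b) ++ codeWord d)

codeWord-linked s []            = [-]
codeWord-linked s ((b , r) ∷ d) = compatible-E s ∷ after-E (partSize (b , r))
  where
  after-E : ∀ n → Linked Compatible (E ∷ replicate n (letter b) ++ codeWord d)
  after-E zero    = codeWord-linked E d
  after-E (suc n) = refl ∷ run-linked b n d

run-linked b zero    d = codeWord-linked (letter b) d
run-linked b (suc n) d = compatible-letter b ∷ run-linked b n d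

-- The start column is chosen so that the charge, start + codeSize d, is n.
encode : ℤ → List Part → VSet
encode n d = toVSet (place (n ℤ.- + codeSize d) (codeWord d))

encode-chargeEnergy : ∀ n d → ∃[ M ] ChargeEnergy (Ω (encode n d)) M n (+ (tri n + codeEnergy d))
encode-chargeEnergy n d with enclosingWindow (n ℤ.- + codeSize d) (length (codeWord d))
... | M , -M≤p , end≤M =
  M , subst₂ (ChargeEnergy (Ω (encode n d)) M) charge energy (place-chargeEnergy (codeWord d) p -M≤p end≤M)
  where
  p = n ℤ.- + codeSize d
  cancel : ∀ n s → n ℤ.- s ℤ.+ s ≡ n
  cancel = solve-∀
  charge : wordCharge p (codeWord d) ≡ n
  charge = trans (wordCharge-codeWord d p) (cancel n (+ codeSize d))
  energy : wordEnergy p (codeWord d) ≡ + (tri n + codeEnergy d)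
  energy = trans (wordEnergy-codeWord d p)
    (trans (cong (λ q → + tri q ℤ.+ + codeEnergy d) (cancel n (+ codeSize d)))
           (sym (ℤ.pos-+ (tri n) (codeEnergy d))))

encode-∈ℂ : ∀ n d → Inℂ (encode n d)
encode-∈ℂ n d =
  toVSet-isConfiguration _ (place-compatible p (codeWord-linked Y d)) ,
  (proj₁ (encode-chargeEnergy n d) , proj₁ (proj₂ (encode-chargeEnergy n d))) ,
  (p , λ i i<p → cong isX (place-left p (codeWord d) i<p) , cong isY (place-left p (codeWord d) i<p))
  where p = n ℤ.- + codeSize d

encode-hasChargeEnergy : ∀ n d → HasChargeEnergy (Ω (encode n d)) n (tri n + codeEnergy d)
encode-hasChargeEnergy n d with encode-chargeEnergy n d
... | M , bound , charge , energy = M , bound , charge , ℤ.+-injective energy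

module _ (d : List Part) (k : ℕ) where

  codeSize-pad : codeSize (d ++ replicate k ∅) ≡ codeSize d
  codeSize-pad = trans (codeSize-++ d _) (trans (cong (_+_ (codeSize d)) (codeSize-empties k)) (+-identityʳ _))

  codeEnergy-pad : codeEnergy (d ++ replicate k ∅) ≡ codeEnergy d
  codeEnergy-pad rewrite codeEnergy-++ d (replicate k ∅) | codeEnergy-empties k | codeSize-empties k
    = trans (cong₂ _+_ (+-identityʳ _) (ℕ.*-zeroʳ (length d))) (+-identityʳ _)

  encode-pad : ∀ n → encode n (d ++ replicate k ∅) ≈ encode n d
  encode-pad n = toVSet-cong λ c →
    begin
    place (n ℤ.- + codeSize (d ++ replicate k ∅)) (codeWord (d ++ replicate k ∅)) c
      ≡⟨ cong₂ (λ s w → place (n ℤ.- + s) w c) codeSize-pad (codeWord-++ d (replicate k ∅)) ⟩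
    place (n ℤ.- + codeSize d) (codeWord d ++ codeWord (replicate k ∅)) c
      ≡⟨ cong (λ w → place (n ℤ.- + codeSize d) (codeWord d ++ w) c) (codeWord-empties k) ⟩
    relative (codeWord d ++ replicate k E) (c ℤ.- (n ℤ.- + codeSize d))
      ≡⟨ relative-++-empty (codeWord d) k (c ℤ.- (n ℤ.- + codeSize d)) ⟩
    place (n ℤ.- + codeSize d) (codeWord d) c ∎
    where open ≡-Reasoning

length-∷ʳ : ∀ {A : Set} (xs : List A) a → length (xs ∷ʳ a) ≡ suc (length xs)
length-∷ʳ xs a = trans (length-++ xs) (+-comm (length xs) 1)

replicate-∷ʳ : ∀ {A : Set} k (a : A) → replicate k a ∷ʳ a ≡ replicate (suc k) a
replicate-∷ʳ zero    a = refl
replicate-∷ʳ (suc k) a = cong (a ∷_) (replicate-∷ʳ k a)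

codeEnergy-∷ʳ∅ : ∀ d → codeEnergy (d ∷ʳ ∅) ≡ codeEnergy d
codeEnergy-∷ʳ∅ d = trans (codeEnergy-∷ʳ d ∅)
  (trans (cong (_+_ (codeEnergy d)) (ℕ.*-zeroʳ (suc (length d)))) (+-identityʳ _))

partSize≡0⇒∅ : ∀ {h} → partSize h ≡ 0 → h ≡ ∅
partSize≡0⇒∅ {false , zero} _ = refl

lastPart-empty : ∀ d h → codeEnergy (d ∷ʳ h) < length (d ∷ʳ h) → h ≡ ∅
lastPart-empty d h E<len with partSize h in size≡
... | zero  = partSize≡0⇒∅ size≡
... | suc m = ⊥-elim (ℕ.<⇒≱ E<len long)
  where
  long : length (d ∷ʳ h) ≤ codeEnergy (d ∷ʳ h)
  long rewrite length-∷ʳ d h | codeEnergy-∷ʳ d h | size≡ =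
    ≤-trans (ℕ.m≤m*n (suc (length d)) (suc m)) (m≤n+m _ (codeEnergy d))

trim : ∀ {d} → Reverse d → codeEnergy d ≤ length d →
       ∃[ d' ] ∃[ k ] (d ≡ d' ++ replicate k ∅ × length d' ≡ codeEnergy d')
trim {d} rd E≤len with length d ≟ codeEnergy d
... | yes len≡E = d , 0 , sym (++-identityʳ d) , len≡E
trim [] _ | no len≢E = ⊥-elim (len≢E refl)
trim (d ∶ rd ∶ʳ h) E≤len | no len≢E with ≤∧≢⇒< E≤len (len≢E ∘ sym)
... | E<len with lastPart-empty d h E<len
... | refl with trim rd (≤-pred (subst₂ _<_ (codeEnergy-∷ʳ∅ d) (length-∷ʳ d ∅) E<len))
... | d' , k , refl , len≡E =
  d' , suc k , trans (++-assoc d' (replicate k ∅) [ ∅ ]) (cong (_++_ d') (replicate-∷ʳ k ∅)) , len≡E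

normalize : ∀ n d →
  ∃[ d' ] (length d' ≡ codeEnergy d' × codeEnergy d' ≡ codeEnergy d × encode n d ≈ encode n d')
normalize n d with length d ≤? codeEnergy d
... | yes len≤E = d ++ replicate k ∅ , balanced , codeEnergy-pad d k , λ v → sym (encode-pad d k n v)
  where
  k = codeEnergy d ∸ length d
  balanced : length (d ++ replicate k ∅) ≡ codeEnergy (d ++ replicate k ∅)
  balanced = begin
    length (d ++ replicate k ∅)          ≡⟨ length-++ d ⟩
    length d + length (replicate k ∅)    ≡⟨ cong (_+_ (length d)) (length-replicate k) ⟩
    length d + k                         ≡⟨ ℕ.m+[n∸m]≡n len≤E ⟩
    codeEnergy d                         ≡⟨ codeEnergy-pad d k ⟨
    codeEnergy (d ++ replicate k ∅)      ∎
    where open ≡-Reasoning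
... | no len≰E with trim (reverseView d) (ℕ.<⇒≤ (ℕ.≰⇒> len≰E))
...   | d' , k , refl , balanced = d' , balanced , sym (codeEnergy-pad d' k) , encode-pad d' k n

-- Parsing words

toPart : ℕ → Bool → Part
toPart zero    _     = ∅
toPart (suc m) true  = true , m
toPart (suc m) false = false , suc m

segment-toPart : ∀ n b → segment (toPart n b) ≡ E ∷ replicate n (letter b)
segment-toPart zero    b     = refl
segment-toPart (suc m) true  = refl
segment-toPart (suc m) false = refl

record Parsed : Set where
  constructor parsed
  field
    run       : ℕ
    runLetter : Bool
    code      : List Part

open Parsed

unparse : Parsed → List Column
unparse (parsed n b d) = replicate n (letter b) ++ codeWord d

parse : List Column → Parsed
parse []      = parsed 0 false []
parse (E ∷ w) = parsed 0 false (toPart (run (parse w)) (runLetter (parse w)) ∷ code (parse w))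
parse (X ∷ w) = parsed (suc (run (parse w))) true  (code (parse w))
parse (Y ∷ w) = parsed (suc (run (parse w))) false (code (parse w))

compatible-letter⇒≡ : ∀ {b b'} → Compatible (letter b) (letter b') → b ≡ b'
compatible-letter⇒≡ {true}  {true}  _ = refl
compatible-letter⇒≡ {false} {false} _ = refl

run-letter : ∀ c n b d → Linked Compatible (letter c ∷ replicate n (letter b) ++ codeWord d) →
  replicate n (letter b) ≡ replicate n (letter c)
run-letter c zero    b d _          = refl
run-letter c (suc n) b d (head ∷ _) =
  cong (λ b → replicate (suc n) (letter b)) (sym (compatible-letter⇒≡ head))

unparse-parse : ∀ {s w} → Linked Compatible (s ∷ w) → unparse (parse w) ≡ w
run-parse     : ∀ c {w} → Linked Compatible (letter c ∷ w) →
  replicate (run (parse w)) (letter c) ++ codeWord (code (parse w)) ≡ w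

unparse-parse {w = []}    _            = refl
unparse-parse {w = E ∷ w} (_ ∷ linked) =
  trans (cong (_++ codeWord (code (parse w))) (segment-toPart (run (parse w)) (runLetter (parse w))))
        (cong (E ∷_) (unparse-parse linked))
unparse-parse {w = X ∷ w} (_ ∷ linked) = cong (X ∷_) (run-parse true linked)
unparse-parse {w = Y ∷ w} (_ ∷ linked) = cong (Y ∷_) (run-parse false linked)

run-parse c {w} linked = trans (cong (_++ codeWord d) (sym (run-letter c n b d linked'))) parsed≡w
  where
  n = run (parse w)
  b = runLetter (parse w)
  d = code (parse w)
  parsed≡w = unparse-parse linked
  linked' = subst (λ v → Linked Compatible (letter c ∷ v)) (sym parsed≡w) linked

parse-run : ∀ b m d → parse (codeWord d) ≡ parsed 0 false d →
  let parsed' = parse (replicate m (letter b) ++ codeWord d) in run parsed' ≡ m × code parsed' ≡ d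
parse-run b     zero    d parse≡ = cong run parse≡ , cong code parse≡
parse-run true  (suc m) d parse≡ = map₁ (cong suc) (parse-run true m d parse≡)
parse-run false (suc m) d parse≡ = map₁ (cong suc) (parse-run false m d parse≡)

parse-codeWord : ∀ d → parse (codeWord d) ≡ parsed 0 false d
parse-codeWord []                  = refl
parse-codeWord ((false , zero) ∷ d) rewrite parse-codeWord d = refl
parse-codeWord ((true , r) ∷ d) with parse-run true r d (parse-codeWord d)
... | run≡ , code≡ = cong₂ (λ k e → parsed 0 false ((true , k) ∷ e)) run≡ code≡
parse-codeWord ((false , suc r) ∷ d) with parse-run false r d (parse-codeWord d)
... | run≡ , code≡ = cong₂ (λ k e → parsed 0 false ((false , suc k) ∷ e)) run≡ code≡

codeWord-injective : ∀ {d d'} → codeWord d ≡ codeWord d' → d ≡ d'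
codeWord-injective {d} {d'} eq =
  cong code (trans (sym (parse-codeWord d)) (trans (cong parse eq) (parse-codeWord d')))

cell-ext : ∀ {w w'} → length w ≡ length w' → (∀ k → cell w k ≡ cell w' k) → w ≡ w'
cell-ext {[]}    {[]}     _   _     = refl
cell-ext {s ∷ w} {s' ∷ w'} len cells = cong₂ _∷_ (cells 0) (cell-ext (ℕ.suc-injective len) (cells ∘ suc))

encode-injective : ∀ n {d d'} → length d ≡ length d' → encode n d ≈ encode n d' → d ≡ d'
encode-injective n {d} {d'} len same = codeWord-injective (cell-ext lengths cells)
  where
  p  = n ℤ.- + codeSize d
  p' = n ℤ.- + codeSize d'
  columns : ∀ c → place p (codeWord d) c ≡ place p' (codeWord d') c
  columns = toVSet-injective same
  left-of : ∀ {a b} → a < b → n ℤ.- + b ℤ.< n ℤ.- + a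
  left-of a<b = ℤ.+-monoʳ-< n (ℤ.neg-mono-< (ℤ.+<+ a<b))
  Y≢E : Y ≢ E
  Y≢E ()
  sizes : codeSize d ≡ codeSize d'
  sizes with ℕ.<-cmp (codeSize d) (codeSize d')
  ... | tri< s<s' _ _ = ⊥-elim (Y≢E (begin
    Y                          ≡⟨ place-left p (codeWord d) (left-of s<s') ⟨
    place p (codeWord d) p'    ≡⟨ columns p' ⟩
    place p' (codeWord d') p'  ≡⟨ place-origin p' (codeWord d') ⟩
    cell (codeWord d') 0       ≡⟨ codeWord-origin d' ⟩
    E                          ∎))
    where open ≡-Reasoning
  ... | tri≈ _ s≡s' _ = s≡s'
  ... | tri> _ _ s>s' = ⊥-elim (Y≢E (begin
    Y                          ≡⟨ place-left p' (codeWord d') (left-of s>s') ⟨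
    place p' (codeWord d') p   ≡⟨ columns p ⟨
    place p (codeWord d) p     ≡⟨ place-origin p (codeWord d) ⟩
    cell (codeWord d) 0        ≡⟨ codeWord-origin d ⟩
    E                          ∎))
    where open ≡-Reasoning
  lengths : length (codeWord d) ≡ length (codeWord d')
  lengths = trans (length-codeWord d) (trans (cong₂ _+_ len sizes) (sym (length-codeWord d')))
  cells : ∀ k → cell (codeWord d) k ≡ cell (codeWord d') k
  cells k = begin
    relative (codeWord d) (+ k)         ≡⟨ cong (relative (codeWord d)) (cancel (+ k) p) ⟨
    place p (codeWord d) (+ k ℤ.+ p)    ≡⟨ columns (+ k ℤ.+ p) ⟩
    place p' (codeWord d') (+ k ℤ.+ p)  ≡⟨ cong (λ s → place (n ℤ.- + s) (codeWord d') (+ k ℤ.+ p)) sizes ⟨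
    place p (codeWord d') (+ k ℤ.+ p)   ≡⟨ cong (relative (codeWord d')) (cancel (+ k) p) ⟩
    relative (codeWord d') (+ k)        ∎
    where
    open ≡-Reasoning
    cancel : ∀ z p → z ℤ.+ p ℤ.- p ≡ z
    cancel = solve-∀

read : (ℤ → Column) → ℤ → ℕ → List Column
read f p zero    = []
read f p (suc n) = f p ∷ read f (p ℤ.+ 1ℤ) n

read-linked : ∀ {f} → (∀ c → Compatible (f c) (f (c ℤ.+ 1ℤ))) →
  ∀ {s} p n → Compatible s (f p) → Linked Compatible (s ∷ read f p n)
read-linked compatible p zero    _     = [-]
read-linked compatible p (suc n) first = first ∷ read-linked compatible (p ℤ.+ 1ℤ) n (compatible p)

place-read : ∀ f n p → (∀ c → p ℤ.+ + n ℤ.≤ c → f c ≡ E) →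
  ∀ c → p ℤ.≤ c → place p (read f p n) c ≡ f c
place-read f zero    p beyond c p≤c =
  trans (place-right p p≤c) (sym (beyond c (subst (ℤ._≤ c) (sym (ℤ.+-identityʳ p)) p≤c)))
place-read f (suc n) p beyond c p≤c with c ℤ.≟ p
... | yes refl = place-origin c (read f c (suc n))
... | no c≢p   = trans (place-drop p (read f p (suc n)) c≢p) (place-read f n (p ℤ.+ 1ℤ) beyond' c p+1≤c)
  where
  beyond' : ∀ c → p ℤ.+ 1ℤ ℤ.+ + n ℤ.≤ c → f c ≡ E
  beyond' c le = beyond c (subst (ℤ._≤ c) (ℤ.+-assoc p 1ℤ (+ n)) le)
  p+1≤c : p ℤ.+ 1ℤ ℤ.≤ c
  p+1≤c = subst (ℤ._≤ c) (ℤ.+-comm 1ℤ p) (ℤ.i<j⇒suc[i]≤j (ℤ.≤∧≢⇒< p≤c (c≢p ∘ sym)))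

+≤-inversion : ∀ {M c} → + M ℤ.≤ c → ∃[ k ] (c ≡ + k × M ≤ k)
+≤-inversion (ℤ.+≤+ M≤k) = _ , refl , M≤k

-∣i∣≤i : ∀ i → ℤ.- (+ ℤ.∣ i ∣) ℤ.≤ i
-∣i∣≤i (+ n)      = ℤ.neg-≤-pos
-∣i∣≤i -[1+ n ]   = ℤ.≤-refl

-- Columns left of -∣N∣ are Y by the tail condition, columns from M on are empty by the Dirac bound.
read-configuration : ∀ {χ} → Inℂ χ →
  ∃[ p ] ∃[ w ] (Linked Compatible (Y ∷ w) × (∀ c → columnOf χ c ≡ place p w c))
read-configuration {χ} (conf , (M , bound) , (N , tail)) = p , w , linked , columns
  where
  p = ℤ.- (+ ℤ.∣ N ∣)
  n = ℤ.∣ N ∣ + M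
  w = read (columnOf χ) p n
  left : ∀ c → c ℤ.< p → columnOf χ c ≡ Y
  left c c<p with tail c (ℤ.<-≤-trans c<p (-∣i∣≤i N))
  ... | x-empty , y-filled rewrite x-empty | y-filled = refl
  end≡M : p ℤ.+ + n ≡ + M
  end≡M = trans (cong (ℤ._+_ p) (ℤ.pos-+ ℤ.∣ N ∣ M)) (cancel (+ ℤ.∣ N ∣) (+ M))
    where cancel : ∀ a m → ℤ.- a ℤ.+ (a ℤ.+ m) ≡ m
          cancel = solve-∀
  beyond : ∀ c → p ℤ.+ + n ℤ.≤ c → columnOf χ c ≡ E
  beyond c end≤c with +≤-inversion (subst (ℤ._≤ c) end≡M end≤c)
  ... | k , refl , M≤k = columnOf-empty χ (proj₁ bound k M≤k)
  columns : ∀ c → columnOf χ c ≡ place p w c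
  columns c with c ℤ.<? p
  ... | yes c<p = trans (left c c<p) (sym (place-left p w c<p))
  ... | no  c≮p = sym (place-read (columnOf χ) n p beyond c (ℤ.≮⇒≥ c≮p))
  linked : Linked Compatible (Y ∷ w)
  linked = read-linked (columnOf-compatible conf) p n first
    where
    undo : p ℤ.- 1ℤ ℤ.+ 1ℤ ≡ p
    undo = trans (ℤ.+-assoc p (ℤ.- 1ℤ) 1ℤ) (ℤ.+-identityʳ p)
    first : Compatible Y (columnOf χ p)
    first = subst₂ Compatible (left (p ℤ.- 1ℤ) (subst (p ℤ.- 1ℤ ℤ.<_) undo (i<i+1 (p ℤ.- 1ℤ))))
      (cong (columnOf χ) undo) (columnOf-compatible conf (p ℤ.- 1ℤ))

decode : ∀ {χ n u} → Inℂ χ → HasChargeEnergy (Ω χ) n u →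
  ∃[ d ] (χ ≈ encode n d × tri n + codeEnergy d ≡ u)
decode {χ} {n} {u} χ∈ (M , bound , charge , energy) with read-configuration χ∈
... | p , w , linked , columns = d , subst (λ m → χ ≈ encode m d) (sym n≡m) χ≈encode , energy≡
  where
  k = run (parse w)
  d = code (parse w)
  q = p ℤ.+ + k
  m = q ℤ.+ + codeSize d
  cancel : ∀ q s → q ℤ.+ s ℤ.- s ≡ q
  cancel = solve-∀
  columns' : ∀ c → columnOf χ c ≡ place (m ℤ.- + codeSize d) (codeWord d) c
  columns' c = begin
    columnOf χ c                          ≡⟨ columns c ⟩
    place p w c                           ≡⟨ cong (λ v → place p v c) (run-parse false linked) ⟨
    place p (replicate k Y ++ codeWord d) c ≡⟨ place-run k p (codeWord d) c ⟩
    place q (codeWord d) c                ≡⟨ cong (λ r → place r (codeWord d) c) (cancel q (+ codeSize d)) ⟨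
    place (m ℤ.- + codeSize d) (codeWord d) c ∎
    where open ≡-Reasoning
  χ≈encode : χ ≈ encode m d
  χ≈encode v = trans (sym (toVSet-columnOf (proj₁ χ∈) v)) (toVSet-cong columns' v)
  same-charge-energy = chargeEnergy-unique {Ω (encode m d)}
    (chargeEnergy-cong {Ω χ} (Ω-cong χ≈encode) (bound , charge , cong +_ energy))
    (proj₂ (encode-chargeEnergy m d))
  n≡m : n ≡ m
  n≡m = proj₁ same-charge-energy
  energy≡ : tri n + codeEnergy d ≡ u
  energy≡ = trans (cong (λ r → tri r + codeEnergy d) n≡m) (sym (ℤ.+-injective (proj₂ same-charge-energy)))

encode-surjective : ∀ {χ n u} → Inℂ χ → HasChargeEnergy (Ω χ) n u →
  ∃[ d ] (length d ≡ codeEnergy d × tri n + codeEnergy d ≡ u × χ ≈ encode n d)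
encode-surjective {χ} {n} χ∈ ce = d' , balanced , trans (cong (_+_ (tri n)) same-energy) energy , χ≈d'
  where
  -- Projections rather than with: with-abstraction would normalise these large proof terms.
  d = proj₁ (decode χ∈ ce)
  energy = proj₂ (proj₂ (decode χ∈ ce))
  d' = proj₁ (normalize n d)
  balanced = proj₁ (proj₂ (normalize n d))
  same-energy = proj₁ (proj₂ (proj₂ (normalize n d)))
  χ≈d' : χ ≈ encode n d'
  χ≈d' v = trans (proj₁ (proj₂ (decode χ∈ ce)) v) (proj₂ (proj₂ (proj₂ (normalize n d))) v)

tri≤energy : ∀ {χ n u} → Inℂ χ → HasChargeEnergy (Ω χ) n u → tri n ≤ u
tri≤energy {n = n} χ∈ ce =
  subst (tri n ≤_) (proj₁ (proj₂ (proj₂ (encode-surjective χ∈ ce)))) (m≤m+n (tri n) _)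

-- Counting codes

length-cartesianProductWith : ∀ {A B C : Set} (h : A → B → C) xs ys →
  length (cartesianProductWith h xs ys) ≡ length xs * length ys
length-cartesianProductWith h []       ys = refl
length-cartesianProductWith h (a ∷ xs) ys = begin
  length (map (h a) ys ++ cartesianProductWith h xs ys)
    ≡⟨ length-++ (map (h a) ys) ⟩
  length (map (h a) ys) + length (cartesianProductWith h xs ys)
    ≡⟨ cong₂ _+_ (length-map (h a) ys) (length-cartesianProductWith h xs ys) ⟩
  length ys + length xs * length ys ∎
  where open ≡-Reasoning

length-concat : ∀ {A : Set} (xss : List (List A)) → length (concat xss) ≡ sum (map length xss)
length-concat []         = refl
length-concat (xs ∷ xss) = trans (length-++ xs) (cong (_+_ (length xs)) (length-concat xss))

module _ {A B C : Set} (h : A → B → C) (F : ℕ → List A) (G : ℕ → List B) where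

  private
    block : ℕ → ℕ → List C
    block k i = cartesianProductWith h (F i) (G (k ∸ i))

  convolve : ℕ → List C
  convolve k = concat (map (block k) (upTo (suc k)))

  length-convolve : ∀ {f g} → (∀ i → length (F i) ≡ f i) → (∀ i → length (G i) ≡ g i) →
    ∀ k → length (convolve k) ≡ (f ⊛ g) k
  length-convolve {f} {g} |F| |G| k = begin
    length (convolve k)                             ≡⟨ length-concat (map (block k) (upTo (suc k))) ⟩
    sum (map length (map (block k) (upTo (suc k)))) ≡⟨ cong sum (map-∘ (upTo (suc k))) ⟨
    sum (map (length ∘ block k) (upTo (suc k)))     ≡⟨ cong sum (map-cong sizes (upTo (suc k))) ⟩
    (f ⊛ g) k                                       ∎
    where
    open ≡-Reasoning
    sizes : ∀ i → length (block k i) ≡ f i * g (k ∸ i)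
    sizes i = trans (length-cartesianProductWith h (F i) (G (k ∸ i))) (cong₂ _*_ (|F| i) (|G| (k ∸ i)))

  ∈-convolve⁺ : ∀ {k i a b} → i ≤ k → a ∈ F i → b ∈ G (k ∸ i) → h a b ∈ convolve k
  ∈-convolve⁺ {k} i≤k a∈ b∈ =
    ∈-concat⁺′ (∈-cartesianProductWith⁺ h a∈ b∈) (∈-map⁺ (block k) (∈-upTo⁺ (s≤s i≤k)))

  ∈-convolve⁻ : ∀ {k c} → c ∈ convolve k →
    ∃[ i ] ∃[ a ] ∃[ b ] (i ≤ k × a ∈ F i × b ∈ G (k ∸ i) × c ≡ h a b)
  ∈-convolve⁻ {k} c∈ with ∈-concat⁻′ (map (block k) (upTo (suc k))) c∈
  ... | cs , c∈cs , cs∈ with ∈-map⁻ (block k) cs∈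
  ... | i , i∈ , refl with ∈-cartesianProductWith⁻ h (F i) (G (k ∸ i)) c∈cs
  ... | a , b , a∈ , b∈ , refl = i , a , b , ≤-pred (∈-upTo⁻ i∈) , a∈ , b∈ , refl

  convolve-unique : (∀ i → Unique (F i)) → (∀ j → Unique (G j)) →
    (∀ {a a' b b'} → h a b ≡ h a' b' → a ≡ a' × b ≡ b') →
    (∀ {a i i'} → a ∈ F i → a ∈ F i' → i ≡ i') → ∀ k → Unique (convolve k)
  convolve-unique F-unique G-unique h-injective F-disjoint k = Unique.concat⁺
    (All.map⁺ (All.tabulate λ {i} _ →
      Unique.cartesianProductWith⁺ h h-injective (F-unique i) (G-unique (k ∸ i))))
    (AllPairs.map⁺ (AllPairs.map disjoint (Unique.upTo⁺ (suc k))))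
    where
    disjoint : ∀ {i i'} → i ≢ i' → Disjoint (block k i) (block k i')
    disjoint i≢i' (v∈ , v∈')
      with ∈-cartesianProductWith⁻ h _ _ v∈ | ∈-cartesianProductWith⁻ h _ _ v∈'
    ... | a , b , a∈ , _ , refl | a' , b' , a'∈ , _ , eq with h-injective eq
    ... | refl , _ = i≢i' (F-disjoint a∈ a'∈)

when : ∀ {A : Set} → Bool → A → List A
when b a = if b then [ a ] else []

length-when : ∀ {A : Set} b (a : A) → length (when b a) ≡ (if b then 1 else 0)
length-when true  a = refl
length-when false a = refl

∈-when⁺ : ∀ {A : Set} {a : A} b → True b → a ∈ when b a
∈-when⁺ true _ = here refl

∈-when⁻ : ∀ {A : Set} {v a : A} b → v ∈ when b a → True b × v ≡ a
∈-when⁻ true (here v≡a) = tt , v≡a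

when-unique : ∀ {A : Set} b (a : A) → Unique (when b a)
when-unique true  a = [] ∷ []
when-unique false a = []

oneL : ℕ → List (List Part)
oneL k = when (k ≡ᵇ 0) []

onePlusL : ℕ → ℕ → List Bool
onePlusL m k = when (k ≡ᵇ 0) false ++ when (k ≡ᵇ m) true

geomL : ℕ → ℕ → List ℕ
geomL j k = when (k % suc j ≡ᵇ 0) (k / suc j)

factorL : ℕ → ℕ → List Part
factorL j = convolve _,_ (onePlusL (suc j)) (geomL j)

-- partialProdL K k lists the codes of length K and energy k.
partialProdL : ℕ → ℕ → List (List Part)
partialProdL zero    = oneL
partialProdL (suc K) = convolve _∷ʳ_ (partialProdL K) (factorL K)

length-partialProdL : ∀ K k → length (partialProdL K k) ≡ partialProd K k
length-partialProdL zero    k = length-when (k ≡ᵇ 0) []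
length-partialProdL (suc K) =
  length-convolve _∷ʳ_ (partialProdL K) (factorL K) (length-partialProdL K) length-factorL
  where
  length-onePlusL : ∀ m k → length (onePlusL m k) ≡ onePlus m k
  length-onePlusL m k = trans (length-++ (when (k ≡ᵇ 0) false))
    (cong₂ _+_ (length-when (k ≡ᵇ 0) false) (length-when (k ≡ᵇ m) true))
  length-factorL : ∀ k → length (factorL K k) ≡ factor K k
  length-factorL = length-convolve _,_ (onePlusL (suc K)) (geomL K)
    (length-onePlusL (suc K)) (λ k → length-when (k % suc K ≡ᵇ 0) (k / suc K))

∈-onePlusL⁻ : ∀ {m i b} → b ∈ onePlusL m i → i ≡ (if b then m else 0)
∈-onePlusL⁻ {m} {i} b∈ with ∈-++⁻ (when (i ≡ᵇ 0) false) b∈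
... | inj₁ b∈₀ with ∈-when⁻ (i ≡ᵇ 0) b∈₀
...   | i≡0 , refl = ℕ.≡ᵇ⇒≡ i 0 i≡0
∈-onePlusL⁻ {m} {i} b∈ | inj₂ b∈ₘ with ∈-when⁻ (i ≡ᵇ m) b∈ₘ
...   | i≡m , refl = ℕ.≡ᵇ⇒≡ i m i≡m

∈-geomL⁻ : ∀ {j t r} → r ∈ geomL j t → t ≡ r * suc j
∈-geomL⁻ {j} {t} r∈ with ∈-when⁻ (t % suc j ≡ᵇ 0) r∈
... | divides , refl =
  trans (m≡m%n+[m/n]*n t (suc j)) (cong (_+ t / suc j * suc j) (ℕ.≡ᵇ⇒≡ _ 0 divides))

∈-geomL⁺ : ∀ j r → r ∈ geomL j (r * suc j)
∈-geomL⁺ j r = subst (_∈ geomL j (r * suc j)) (m*n/n≡m r (suc j))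
  (∈-when⁺ (r * suc j % suc j ≡ᵇ 0) (ℕ.≡⇒≡ᵇ _ 0 (m*n%n≡0 r (suc j))))

∈-factorL⁻ : ∀ {j t h} → h ∈ factorL j t → suc j * partSize h ≡ t
∈-factorL⁻ {j} {t} h∈ with ∈-convolve⁻ _,_ (onePlusL (suc j)) (geomL j) h∈
... | i , b , r , i≤t , b∈ , r∈ , refl = degree b i i≤t (∈-onePlusL⁻ b∈) (∈-geomL⁻ r∈)
  where
  degree : ∀ b i → i ≤ t → i ≡ (if b then suc j else 0) → t ∸ i ≡ r * suc j →
    suc j * partSize (b , r) ≡ t
  degree false _ _   refl rest = trans (ℕ.*-comm (suc j) r) (sym rest)
  degree true  _ i≤t refl rest = begin
    suc j * suc r         ≡⟨ ℕ.*-suc (suc j) r ⟩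
    suc j + suc j * r     ≡⟨ cong (_+_ (suc j)) (trans (ℕ.*-comm (suc j) r) (sym rest)) ⟩
    suc j + (t ∸ suc j)   ≡⟨ ℕ.m+[n∸m]≡n i≤t ⟩
    t                     ∎
    where open ≡-Reasoning

∈-factorL⁺ : ∀ j h → h ∈ factorL j (suc j * partSize h)
∈-factorL⁺ j (false , r) = ∈-convolve⁺ _,_ (onePlusL (suc j)) (geomL j) {suc j * r} z≤n (here refl)
  (subst (λ t → r ∈ geomL j t) (ℕ.*-comm r (suc j)) (∈-geomL⁺ j r))
∈-factorL⁺ j (true , r) = ∈-convolve⁺ _,_ (onePlusL (suc j)) (geomL j) (ℕ.m≤m*n (suc j) (suc r))
  (∈-++⁺ʳ (when (suc j ≡ᵇ 0) false) (∈-when⁺ (suc j ≡ᵇ suc j) (ℕ.≡⇒≡ᵇ (suc j) _ refl)))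
  (subst (λ t → r ∈ geomL j t) rest (∈-geomL⁺ j r))
  where
  rest : r * suc j ≡ suc j * suc r ∸ suc j
  rest = sym (begin
    suc j * suc r ∸ suc j        ≡⟨ cong (_∸ suc j) (ℕ.*-suc (suc j) r) ⟩
    suc j + suc j * r ∸ suc j    ≡⟨ ℕ.m+n∸m≡n (suc j) (suc j * r) ⟩
    suc j * r                    ≡⟨ ℕ.*-comm (suc j) r ⟩
    r * suc j                    ∎)
    where open ≡-Reasoning

∈-partialProdL⁻ : ∀ K {k d} → d ∈ partialProdL K k → length d ≡ K × codeEnergy d ≡ k
∈-partialProdL⁻ zero    {zero}  (here refl) = refl , refl
∈-partialProdL⁻ (suc K) {k}     d∈ with ∈-convolve⁻ _∷ʳ_ (partialProdL K) (factorL K) d∈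
... | i , d , h , i≤k , d∈' , h∈ , refl with ∈-partialProdL⁻ K d∈'
... | refl , refl = length-∷ʳ d h , (begin
  codeEnergy (d ∷ʳ h)                            ≡⟨ codeEnergy-∷ʳ d h ⟩
  codeEnergy d + suc (length d) * partSize h     ≡⟨ cong (_+_ (codeEnergy d)) (∈-factorL⁻ h∈) ⟩
  codeEnergy d + (k ∸ codeEnergy d)              ≡⟨ ℕ.m+[n∸m]≡n i≤k ⟩
  k                                              ∎)
  where open ≡-Reasoning

∈-partialProdL⁺ : ∀ d → d ∈ partialProdL (length d) (codeEnergy d)
∈-partialProdL⁺ d = go (reverseView d)
  where
  go : ∀ {d} → Reverse d → d ∈ partialProdL (length d) (codeEnergy d)
  go []              = here refl
  go (d ∶ rd ∶ʳ h) rewrite length-∷ʳ d h | codeEnergy-∷ʳ d h =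
    ∈-convolve⁺ _∷ʳ_ (partialProdL (length d)) (factorL (length d)) (m≤m+n (codeEnergy d) _) (go rd)
      (subst (λ t → h ∈ factorL (length d) t) (sym (ℕ.m+n∸m≡n (codeEnergy d) _))
        (∈-factorL⁺ (length d) h))

partialProdL-unique : ∀ K k → Unique (partialProdL K k)
partialProdL-unique zero    k = when-unique (k ≡ᵇ 0) []
partialProdL-unique (suc K) = convolve-unique _∷ʳ_ (partialProdL K) (factorL K)
  (partialProdL-unique K) factorL-unique (λ {d} {d'} → ∷ʳ-injective d d')
  (λ d∈ d∈' → trans (sym (proj₂ (∈-partialProdL⁻ K d∈))) (proj₂ (∈-partialProdL⁻ K d∈')))
  where
  onePlusL-unique : ∀ m k → Unique (onePlusL m k)
  onePlusL-unique m k with k ≡ᵇ 0 | k ≡ᵇ m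
  ... | true  | true  = ((λ ()) ∷ []) ∷ [] ∷ []
  ... | true  | false = [] ∷ []
  ... | false | true  = [] ∷ []
  ... | false | false = []
  factorL-unique : ∀ k → Unique (factorL K k)
  factorL-unique = convolve-unique _,_ (onePlusL (suc K)) (geomL K)
    (onePlusL-unique (suc K)) (λ k → when-unique (k % suc K ≡ᵇ 0) (k / suc K)) (λ { refl → refl , refl })
    (λ b∈ b∈' → trans (∈-onePlusL⁻ b∈) (sym (∈-onePlusL⁻ b∈')))

allPairs-map⁺ : ∀ {A B : Set} {P : A → Set} {R : A → A → Set} {S : B → B → Set} {f : A → B} {xs} →
  All P xs → AllPairs R xs → (∀ {a b} → P a → P b → R a b → S (f a) (f b)) → AllPairs S (map f xs)
allPairs-map⁺ []         []         _    = []
allPairs-map⁺ (pa ∷ pas) (ra ∷ ras) lift =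
  All.map⁺ (All.zipWith (λ (pb , rab) → lift pa pb rab) (pas , ra)) ∷ allPairs-map⁺ pas ras lift

module _ (n : ℤ) (k : ℕ) where

  encodings : List VSet
  encodings = map (encode n) (partialProdL k k)

  length-encodings : length encodings ≡ infProd k
  length-encodings = trans (length-map (encode n) (partialProdL k k)) (length-partialProdL k k)

  encodings-∈ℂ : All (λ χ → Inℂ χ × HasChargeEnergy (Ω χ) n (tri n + k)) encodings
  encodings-∈ℂ = All.map⁺ (All.tabulate λ {d} d∈ → encode-∈ℂ n d ,
    subst (HasChargeEnergy (Ω (encode n d)) n ∘ _+_ (tri n)) (proj₂ (∈-partialProdL⁻ k d∈))
      (encode-hasChargeEnergy n d))

  encodings-distinct : AllPairs (λ χ ψ → ¬ (χ ≈ ψ)) encodings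
  encodings-distinct =
    allPairs-map⁺ (All.tabulate (proj₁ ∘ ∈-partialProdL⁻ k)) (partialProdL-unique k k)
      λ length≡k length'≡k d≢d' same → d≢d' (encode-injective n (trans length≡k (sym length'≡k)) same)

  encodings-complete : ∀ χ → Inℂ χ → HasChargeEnergy (Ω χ) n (tri n + k) → Any (χ ≈_) encodings
  encodings-complete χ χ∈ ce = Any.map⁺ (Any.map χ≈ d∈)
    where
    surjective = encode-surjective χ∈ ce
    d = proj₁ surjective
    energy≡k : codeEnergy d ≡ k
    energy≡k = ℕ.+-cancelˡ-≡ (tri n) _ _ (proj₁ (proj₂ (proj₂ surjective)))
    d∈ : d ∈ partialProdL k k
    d∈ = subst₂ (λ K e → d ∈ partialProdL K e) (trans (proj₁ (proj₂ surjective)) energy≡k) energy≡k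
      (∈-partialProdL⁺ d)
    χ≈ : ∀ {e} → d ≡ e → χ ≈ encode n e
    χ≈ refl = proj₂ (proj₂ (proj₂ surjective))

proposition1 : (n : ℤ) (u : ℕ) →
    ∃[ cs ] (length cs ≡ rhsCoeff n u
      × All (λ χ → Inℂ χ × HasChargeEnergy (Ω χ) n u) cs
      × AllPairs (λ χ ψ → ¬ (χ ≈ ψ)) cs
      × (∀ χ → Inℂ χ → HasChargeEnergy (Ω χ) n u → Any (χ ≈_) cs))
proposition1 n u with tri n ≤? u
... | no  n≰u = [] , refl , [] , [] , λ χ χ∈ ce → ⊥-elim (n≰u (tri≤energy χ∈ ce))
... | yes n≤u with u ∸ tri n | ℕ.m+[n∸m]≡n n≤u
...   | k | refl =
  encodings n k , length-encodings n k , encodings-∈ℂ n k , encodings-distinct n k , encodings-complete n k
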